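{- Let $\sigma$ be a permutation. Then: (1) $\sigma$ avoids the pattern $1234$ if and only if the board $B_\sigma$ avoids the board $B_{1234}$; (2) $\sigma$ avoids both patterns $1324$ and $3416725$ if and only if $B_\sigma$ avoids both boards $B_{1324}$ and $B_{3416725}$.
   Context: For $\sigma \in S_n$, let $M_\sigma$ be the $n\times n$ board filled with 0's and 1's having a 1 exactly in column $i$ (counted left to right) and row $\sigma(i)$ (counted bottom to top) for $1\le i\le n$. Position $i$ is a left-to-right (LR) minimum of $\sigma$ if $\sigma(j)>\sigma(i)$ for all $j<i$, and a right-to-left (RL) maximum if $\sigma(j)<\sigma(i)$ for all $j>i$. The board $B_\sigma$ is obtained from $M_\sigma$ by removing every cell that is not both above and to the right of some LR-minimum entry and below and to the left of some RL-maximum entry, and also removing all rows and columns containing LR-minima or RL-maxima; the remaining rows and columns are renumbered consecutively, and $B_\sigma$ is a (possibly empty) $(0,1)$-filled board. Concretely: $B_{1234}$ is the full $2\times 2$ board with 1's in (column 1, row 1) and (column 2, row 2); $B_{1324}$ is the full $2\times 2$ board with 1's in (column 1, row 2) and (column 2, row 1); $B_{3416725}$ is the $3\times 3$ skew board whose bottom row consists of the cells in columns 2,3, middle row of columns 1,2,3, top row of columns 1,2, with 1's in (column 1, row 2), (column 2, row 3), (column 3, row 1) and 0's elsewhere. A nice board is a skew-Ferrers board with equally many rows and columns containing the antidiagonal. A $(0,1)$-filled nice board $B$ contains a $(0,1)$-filled nice board $B'$ if $B'$ can be obtained from $B$ by deleting an equal number of rows and columns (i.e. there are $k$ rows and $k$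 columns of $B$ such that the cells of $B$ at their intersections, with their entries and after renumbering, form exactly $B'$, both in shape and in filling); otherwise $B$ avoids $B'$. Pattern containment/avoidance for permutations is the classical one (subsequence order-isomorphic to the pattern). -}

module Defs where

open import Data.Bool using (Bool; true; false; _∧_; _∨_; not; if_then_else_)
open import Data.Nat using (ℕ; zero; suc) renaming (_<ᵇ_ to _<ℕᵇ_; _≡ᵇ_ to _≡ℕᵇ_)
open import Data.Fin using (Fin; toℕ; _<_; #_) renaming (zero to fz; suc to fs)
open import Data.List using (List; allFin; filterᵇ; length; lookup)
open import Data.Bool.ListAction using (all; any)
open import Data.Maybe using (Maybe; just; nothing)
open import Data.Vec using (Vec; []; _∷_) renaming (lookup to vlookup)
open import Data.Product using (Σ; _×_; _,_)
open import Function.Bundles using (_⇔_)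
open import Relation.Binary.PropositionalEquality using (_≡_)

-- Conventions: columns and rows are 0-indexed (column i = position i,
-- counted left to right; row r counted bottom to top).  A permutation
-- (or pattern) is given by its map  column ↦ row.

_<ᵇ_ : ∀ {n} → Fin n → Fin n → Bool
i <ᵇ j = toℕ i <ℕᵇ toℕ j

_≡ᵇ_ : ∀ {n} → Fin n → Fin n → Bool
i ≡ᵇ j = toℕ i ≡ℕᵇ toℕ j

StrictlyIncreasing : ∀ {k n} → (Fin k → Fin n) → Set
StrictlyIncreasing f = ∀ i j → i < j → f i < f j

Contains : ∀ {n k} → (Fin n → Fin n) → (Fin k → Fin k) → Set
Contains {n} {k} σ π =
  Σ (Fin k → Fin n) λ f → StrictlyIncreasing f ×
    (∀ i j → (σ (f i) < σ (f j)) ⇔ (π i < π j))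

Avoids : ∀ {n k} → (Fin n → Fin n) → (Fin k → Fin k) → Set
Avoids σ π = Contains σ π → Data.Empty.⊥
  where import Data.Empty

-- the patterns, in one-line notation (0-indexed values)
p1234 : Fin 4 → Fin 4
p1234 i = vlookup (# 0 ∷ # 1 ∷ # 2 ∷ # 3 ∷ []) i

p1324 : Fin 4 → Fin 4
p1324 i = vlookup (# 0 ∷ # 2 ∷ # 1 ∷ # 3 ∷ []) i

p3416725 : Fin 7 → Fin 7
p3416725 i = vlookup (# 2 ∷ # 3 ∷ # 0 ∷ # 5 ∷ # 6 ∷ # 1 ∷ # 4 ∷ []) i

-- A board has a number of columns and rows; the
-- entry at (column i, row j) is  nothing  if the cell is not in the
-- board, and  just b  (b = true for 1, false for 0) if it is.

record Board : Set where
  constructor board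
  field
    cols : ℕ
    rows : ℕ
    cell : Fin cols → Fin rows → Maybe Bool
open Board public

BContains : Board → Board → Set
BContains B B' =
  Σ (Fin (cols B') → Fin (cols B)) λ f →
  Σ (Fin (rows B') → Fin (rows B)) λ g →
    StrictlyIncreasing f × StrictlyIncreasing g ×
    (∀ i j → cell B (f i) (g j) ≡ cell B' i j)

BAvoids : Board → Board → Set
BAvoids B B' = BContains B B' → Data.Empty.⊥
  where import Data.Empty

module _ {n : ℕ} (σ : Fin n → Fin n) where

  isLRmin : Fin n → Bool
  isLRmin i = all (λ j → not (j <ᵇ i) ∨ (σ i <ᵇ σ j)) (allFin n)

  isRLmax : Fin n → Bool
  isRLmax i = all (λ j → not (i <ᵇ j) ∨ (σ j <ᵇ σ i)) (allFin n)

  special : Fin n → Bool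
  special i = isLRmin i ∨ isRLmax i

  keptCol : Fin n → Bool
  keptCol c = not (special c)

  keptRow : Fin n → Bool
  keptRow r = not (any (λ i → (σ i ≡ᵇ r) ∧ special i) (allFin n))

  inRegion : Fin n → Fin n → Bool
  inRegion c r =
    any (λ a → isLRmin a ∧ (a <ᵇ c) ∧ (σ a <ᵇ r)) (allFin n) ∧
    any (λ b → isRLmax b ∧ (c <ᵇ b) ∧ (r <ᵇ σ b)) (allFin n)

  keptCols : List (Fin n)
  keptCols = filterᵇ keptCol (allFin n)

  keptRows : List (Fin n)
  keptRows = filterᵇ keptRow (allFin n)

  B : Board
  B = board (length keptCols) (length keptRows) λ i j →
        let c = lookup keptCols i ; r = lookup keptRows j in
        if inRegion c r then just (σ c ≡ᵇ r) else nothing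

B1234 : Board
B1234 = board 2 2 cl
  where
  cl : Fin 2 → Fin 2 → Maybe Bool
  cl fz fz = just true
  cl fz (fs fz) = just false
  cl (fs fz) fz = just false
  cl (fs fz) (fs fz) = just true

B1324 : Board
B1324 = board 2 2 cl
  where
  cl : Fin 2 → Fin 2 → Maybe Bool
  cl fz fz = just false
  cl fz (fs fz) = just true
  cl (fs fz) fz = just true
  cl (fs fz) (fs fz) = just false

B3416725 : Board
B3416725 = board 3 3 cl
  where
  cl : Fin 3 → Fin 3 → Maybe Bool
  cl fz fz = nothing
  cl fz (fs fz) = just true
  cl fz (fs (fs fz)) = just false
  cl (fs fz) fz = just false
  cl (fs fz) (fs fz) = just false
  cl (fs fz) (fs (fs fz)) = just true
  cl (fs (fs fz)) fz = just true
  cl (fs (fs fz)) (fs fz) = just false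
  cl (fs (fs fz)) (fs (fs fz)) = nothing

module Submission where

-- A grid cell (c , r)
-- lies in the region of B σ iff some entry of σ is strictly south-west of it
-- and some entry strictly north-east (region⇔): any such entry can be pushed
-- down to an LR-minimum, resp. up to an RL-maximum, by a terminating descent.
-- An entry with neighbours on both sides keeps its column and its row, and a
-- copy of a board B′ inside B σ is the same as a placement of B′ on original
-- columns and rows of σ (placement⇔), whose cells are read off by cell-one,
-- cell-zero, cell-empty and their converses.  With this dictionary each
-- pattern is translated directly: the middle entries of 1234 / 1324, framed
-- by the two outer ones, carry B1234 / B1324, and conversely; the entries
-- 4, 6, 2 of 3416725 carry B3416725, its empty corners being forced by
-- 1324-avoidance, and conversely the empty corners of a copy of B3416725
-- force the surrounding entries into a 3416725.  The theorem follows by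
-- negating these equivalences.

open import Defs
open import Data.Nat using (ℕ)
open import Data.Product using (_×_)
open import Data.Fin.Permutation using (Permutation′; _⟨$⟩ʳ_)
open import Function.Bundles using (_⇔_)

open import Data.Bool using (Bool; true; false; T; not; _∧_; _∨_; if_then_else_)
open import Data.Bool.Properties using (T?; T-∧; T-∨; T-≡; T-not-≡)
import Data.Nat as ℕ
import Data.Nat.Properties as ℕ
open import Data.Fin using (Fin; toℕ; _<_; _>_; inject₁; #_) renaming (zero to fz; suc to fs)
open import Data.Fin.Properties using (_<?_; <-cmp; <⇒≢; <-respˡ-≡; <-respʳ-≡; toℕ-injective)
open import Data.Fin.Induction using (<-wellFounded; >-wellFounded)
open import Data.List using (List; allFin; filterᵇ; length; lookup)
open import Data.Bool.ListAction using (all; any)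
open import Data.List.Membership.Propositional using (_∈_; lose)
open import Data.List.Membership.Propositional.Properties using (∈-allFin; ∈-filter⁺; ∈-filter⁻; ∈-lookup)
import Data.List.Relation.Unary.All as All
open import Data.List.Relation.Unary.All.Properties using (all⁺; all⁻; ¬All⇒Any¬)
import Data.List.Relation.Unary.Any as Any
open import Data.List.Relation.Unary.Any.Properties using (any⁺; any⁻; lookup-index)
open import Data.List.Relation.Unary.AllPairs using (AllPairs; _∷_)
import Data.List.Relation.Unary.AllPairs.Properties as AllPairs
open import Data.Maybe using (Maybe; just; nothing)
open import Data.Maybe.Properties using (just-injective)
open import Data.Vec using ([]; _∷_) renaming (lookup to vlookup)
open import Data.Product using (Σ; ∃; _,_; proj₁; proj₂)
open import Data.Sum using (inj₁; inj₂)
open import Data.Empty using (⊥-elim)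
open import Data.Unit using (tt)
open import Function using (_∘_)
open import Function.Bundles using (Equivalence; Injection; mk⇔)
open import Function.Properties.Inverse using (↔⇒↣)
open import Function.Related.TypeIsomorphisms using (¬-cong-⇔)
open import Induction.WellFounded using (Acc; acc)
open import Relation.Nullary using (¬_; yes; no)
open import Relation.Nullary.Decidable using (True; toWitness)
open import Relation.Binary.Definitions using (tri<; tri≈; tri>)
open import Relation.Binary.PropositionalEquality
  using (_≡_; _≢_; refl; sym; trans; cong; cong₂; subst; subst₂)

open Equivalence using (to; from)

T-not : ∀ {b} → ¬ T b → T (not b)
T-not {false} _ = tt
T-not {true} ¬t = ¬t tt

T-implies : ∀ {x y} → T (not x ∨ y) → T x → T y
T-implies {true} t _ = t

T-implies⁻ : ∀ {x y} → ¬ T (not x ∨ y) → T x × ¬ T y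
T-implies⁻ {false} h = ⊥-elim (h tt)
T-implies⁻ {true} {true} h = ⊥-elim (h tt)
T-implies⁻ {true} {false} _ = tt , (λ ())

<ᵇ⇔< : ∀ {n} {i j : Fin n} → T (i <ᵇ j) ⇔ i < j
<ᵇ⇔< {i = i} {j} = mk⇔ (ℕ.<ᵇ⇒< (toℕ i) (toℕ j)) ℕ.<⇒<ᵇ

≡ᵇ⇔≡ : ∀ {n} {i j : Fin n} → T (i ≡ᵇ j) ⇔ i ≡ j
≡ᵇ⇔≡ {i = i} {j} = mk⇔ (toℕ-injective ∘ ℕ.≡ᵇ⇒≡ (toℕ i) (toℕ j)) (ℕ.≡⇒≡ᵇ (toℕ i) (toℕ j) ∘ cong toℕ)

module _ {n : ℕ} (p : Fin n → Bool) where

  all-allFin : T (all p (allFin n)) → ∀ i → T (p i)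
  all-allFin t i = All.lookup (all⁺ p (allFin n) t) (∈-allFin i)

  ¬all-allFin : ¬ T (all p (allFin n)) → ∃ λ i → ¬ T (p i)
  ¬all-allFin ¬t = Any.satisfied (¬All⇒Any¬ (T? ∘ p) (allFin n) (¬t ∘ all⁻ p))

  any-allFin : T (any p (allFin n)) ⇔ (∃ λ i → T (p i))
  any-allFin = mk⇔ (Any.satisfied ∘ any⁻ p (allFin n))
                   (λ (i , t) → any⁺ p (lose (∈-allFin i) t))

≮∧≢⇒> : ∀ {n} {i j : Fin n} → ¬ i < j → i ≢ j → j < i
≮∧≢⇒> {i = i} {j} i≮j i≢j with <-cmp i j
... | tri< i<j _ _ = ⊥-elim (i≮j i<j)
... | tri≈ _ i≡j _ = ⊥-elim (i≢j i≡j)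
... | tri> _ _ j<i = j<i

-- a literal comparison  # i < # j  checked by evaluation
lit : ∀ {k} (i j : Fin k) → {True (i <? j)} → i < j
lit i j {t} = toWitness t

increasing-reflects : ∀ {k m} {f : Fin k → Fin m} → StrictlyIncreasing f →
  ∀ {i j} → f i < f j → i < j
increasing-reflects inc {i} {j} fi<fj with <-cmp i j
... | tri< i<j _ _ = i<j
... | tri≈ _ refl _ = ⊥-elim (ℕ.<-irrefl refl fi<fj)
... | tri> _ _ j<i = ⊥-elim (ℕ.<-asym fi<fj (inc j i j<i))

Chain : ∀ {k m} → (Fin (ℕ.suc k) → Fin m) → Set
Chain {k} h = ∀ (i : Fin k) → h (inject₁ i) < h (fs i)

chain⇒increasing : ∀ {k m} (h : Fin (ℕ.suc k) → Fin m) → Chain h → StrictlyIncreasing h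
chain⇒increasing {ℕ.suc k} h steps fz (fs fz) _ = steps fz
chain⇒increasing {ℕ.suc k} h steps fz (fs (fs j)) _ =
  ℕ.<-trans (steps fz) (chain⇒increasing (h ∘ fs) (steps ∘ fs) fz (fs j) ℕ.z<s)
chain⇒increasing {ℕ.suc k} h steps (fs i) (fs j) (ℕ.s<s i<j) =
  chain⇒increasing (h ∘ fs) (steps ∘ fs) i j i<j

-- The elements of Fin n passing a test p, listed in increasing order: the
-- kept columns and kept rows of the board B σ are such enumerations.
module Enumeration {n : ℕ} (p : Fin n → Bool) where

  elems : List (Fin n)
  elems = filterᵇ p (allFin n)

  elem : Fin (length elems) → Fin n
  elem = lookup elems

  private
    lookup-increasing : ∀ {xs : List (Fin n)} → AllPairs _<_ xs →
      ∀ i j → i < j → lookup xs i < lookup xs j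
    lookup-increasing (x<xs ∷ _) fz (fs j) _ = All.lookup x<xs (∈-lookup j)
    lookup-increasing (_ ∷ sorted) (fs i) (fs j) (ℕ.s<s i<j) = lookup-increasing sorted i j i<j

  elem-increasing : StrictlyIncreasing elem
  elem-increasing = lookup-increasing
    (AllPairs.filter⁺ (T? ∘ p) (AllPairs.tabulate⁺-< {f = λ i → i} (λ i<j → i<j)))

  elem-passes : ∀ i → T (p (elem i))
  elem-passes i = proj₂ (∈-filter⁻ (T? ∘ p) {xs = allFin n} (∈-lookup i))

  subfamily : ∀ {k} (h : Fin k → Fin n) → StrictlyIncreasing h → (∀ i → T (p (h i))) →
    Σ (Fin k → Fin (length elems)) λ g → StrictlyIncreasing g × (∀ i → elem (g i) ≡ h i)
  subfamily {k} h inc passes = g , g-increasing , g-correct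
    where
    position : ∀ i → h i ∈ elems
    position i = ∈-filter⁺ (T? ∘ p) (∈-allFin (h i)) (passes i)
    g : Fin k → Fin (length elems)
    g i = Any.index (position i)
    g-correct : ∀ i → elem (g i) ≡ h i
    g-correct i = sym (lookup-index (position i))
    g-increasing : StrictlyIncreasing g
    g-increasing i j i<j = increasing-reflects elem-increasing
      (subst₂ _<_ (sym (g-correct i)) (sym (g-correct j)) (inc i j i<j))

p3416725⁻¹ : Fin 7 → Fin 7
p3416725⁻¹ i = vlookup (# 2 ∷ # 5 ∷ # 0 ∷ # 1 ∷ # 6 ∷ # 3 ∷ # 4 ∷ []) i

p3416725⁻¹∘p3416725 : ∀ i → p3416725⁻¹ (p3416725 i) ≡ i
p3416725⁻¹∘p3416725 fz = refl
p3416725⁻¹∘p3416725 (fs fz) = refl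
p3416725⁻¹∘p3416725 (fs (fs fz)) = refl
p3416725⁻¹∘p3416725 (fs (fs (fs fz))) = refl
p3416725⁻¹∘p3416725 (fs (fs (fs (fs fz)))) = refl
p3416725⁻¹∘p3416725 (fs (fs (fs (fs (fs fz))))) = refl
p3416725⁻¹∘p3416725 (fs (fs (fs (fs (fs (fs fz)))))) = refl

module _ {n : ℕ} (σ : Fin n → Fin n) where

  -- An occurrence of π is given by its positions f, listed left to right;
  -- it suffices that f increases and that the values, listed in the order
  -- prescribed by π (i.e. σ ∘ f ∘ π⁻¹), increase.
  occurrence : ∀ {k} (π π⁻¹ : Fin (ℕ.suc k) → Fin (ℕ.suc k)) → (∀ i → π⁻¹ (π i) ≡ i) →
    (f : Fin (ℕ.suc k) → Fin n) → Chain f → Chain (σ ∘ f ∘ π⁻¹) → Contains σ π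
  occurrence {k} π π⁻¹ π⁻¹∘π f f-steps value-steps =
    f , chain⇒increasing f f-steps , λ i j → mk⇔ (order-of-values i j) (values-ordered i j)
    where
    value : Fin (ℕ.suc k) → Fin n
    value = σ ∘ f ∘ π⁻¹
    value-increasing : StrictlyIncreasing value
    value-increasing = chain⇒increasing value value-steps
    value-π : ∀ i → value (π i) ≡ σ (f i)
    value-π i = cong (σ ∘ f) (π⁻¹∘π i)
    values-ordered : ∀ i j → π i < π j → σ (f i) < σ (f j)
    values-ordered i j πi<πj =
      subst₂ _<_ (value-π i) (value-π j) (value-increasing (π i) (π j) πi<πj)
    order-of-values : ∀ i j → σ (f i) < σ (f j) → π i < π j
    order-of-values i j fi<fj =
      increasing-reflects value-increasing (subst₂ _<_ (sym (value-π i)) (sym (value-π j)) fi<fj)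

  module Occurrence {k} {π : Fin k → Fin k} (occ : Contains σ π) where

    pos : Fin k → Fin n
    pos = proj₁ occ

    pos< : ∀ i j → {True (i <? j)} → pos i < pos j
    pos< i j {t} = proj₁ (proj₂ occ) i j (lit i j {t})

    val< : ∀ i j → {True (π i <? π j)} → σ (pos i) < σ (pos j)
    val< i j {t} = from (proj₂ (proj₂ occ) i j) (lit (π i) (π j) {t})

  1234-occurrence : ∀ {a b c d} → a < b → b < c → c < d →
    σ a < σ b → σ b < σ c → σ c < σ d → Contains σ p1234
  1234-occurrence {a} {b} {c} {d} a<b b<c c<d σa<σb σb<σc σc<σd =
    occurrence p1234 p1234 (λ { fz → refl ; (fs fz) → refl ; (fs (fs fz)) → refl ; (fs (fs (fs fz))) → refl })
      (λ i → vlookup (a ∷ b ∷ c ∷ d ∷ []) i)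
      (λ { fz → a<b ; (fs fz) → b<c ; (fs (fs fz)) → c<d })
      (λ { fz → σa<σb ; (fs fz) → σb<σc ; (fs (fs fz)) → σc<σd })

  1324-occurrence : ∀ {a b c d} → a < b → b < c → c < d →
    σ a < σ c → σ c < σ b → σ b < σ d → Contains σ p1324
  1324-occurrence {a} {b} {c} {d} a<b b<c c<d σa<σc σc<σb σb<σd =
    occurrence p1324 p1324 (λ { fz → refl ; (fs fz) → refl ; (fs (fs fz)) → refl ; (fs (fs (fs fz))) → refl })
      (λ i → vlookup (a ∷ b ∷ c ∷ d ∷ []) i)
      (λ { fz → a<b ; (fs fz) → b<c ; (fs (fs fz)) → c<d })
      (λ { fz → σa<σc ; (fs fz) → σc<σb ; (fs (fs fz)) → σb<σd })

module Geometry {n : ℕ} (σ : Fin n → Fin n) (σ-injective : ∀ {a b} → σ a ≡ σ b → a ≡ b) where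

  SW : Fin n → Fin n → Set
  SW c r = ∃ λ a → a < c × σ a < r

  NE : Fin n → Fin n → Set
  NE c r = ∃ λ b → c < b × r < σ b

  private
    σ-distinct : ∀ {a c} → a < c → σ c ≢ σ a
    σ-distinct a<c = (<⇒≢ a<c ∘ sym) ∘ σ-injective

  LRmin⇒¬SW : ∀ {c} → T (isLRmin σ c) → ¬ SW c (σ c)
  LRmin⇒¬SW isMin (a , a<c , σa<σc) =
    ℕ.<-asym σa<σc (to <ᵇ⇔< (T-implies (all-allFin _ isMin a) (from <ᵇ⇔< a<c)))

  ¬LRmin⇒SW : ∀ {c} → ¬ T (isLRmin σ c) → SW c (σ c)
  ¬LRmin⇒SW ¬isMin with ¬all-allFin _ ¬isMin
  ... | a , ¬t with T-implies⁻ ¬t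
  ... | a<c , σc≮σa = a , to <ᵇ⇔< a<c , ≮∧≢⇒> (σc≮σa ∘ from <ᵇ⇔<) (σ-distinct (to <ᵇ⇔< a<c))

  RLmax⇒¬NE : ∀ {c} → T (isRLmax σ c) → ¬ NE c (σ c)
  RLmax⇒¬NE isMax (b , c<b , σc<σb) =
    ℕ.<-asym σc<σb (to <ᵇ⇔< (T-implies (all-allFin _ isMax b) (from <ᵇ⇔< c<b)))

  ¬RLmax⇒NE : ∀ {c} → ¬ T (isRLmax σ c) → NE c (σ c)
  ¬RLmax⇒NE ¬isMax with ¬all-allFin _ ¬isMax
  ... | b , ¬t with T-implies⁻ ¬t
  ... | c<b , σb≮σc = b , to <ᵇ⇔< c<b , ≮∧≢⇒> (σb≮σc ∘ from <ᵇ⇔<) (σ-distinct (to <ᵇ⇔< c<b))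

  -- Every entry south-west of a point can be pushed down-left to an
  -- LR-minimum south-west of it (descent along non-minima terminates);
  -- dually for RL-maxima.
  LRmin-SW : ∀ {c r : Fin n} a → Acc _<_ a → a < c → σ a < r → ∃ λ a′ → T (isLRmin σ a′) × a′ < c × σ a′ < r
  LRmin-SW a (acc smaller) a<c σa<r with T? (isLRmin σ a)
  ... | yes isMin = a , isMin , a<c , σa<r
  ... | no ¬isMin with ¬LRmin⇒SW ¬isMin
  ... | a′ , a′<a , σa′<σa =
    LRmin-SW a′ (smaller a′<a) (ℕ.<-trans a′<a a<c) (ℕ.<-trans σa′<σa σa<r)

  RLmax-NE : ∀ {c r : Fin n} b → Acc _>_ b → c < b → r < σ b → ∃ λ b′ → T (isRLmax σ b′) × c < b′ × r < σ b′
  RLmax-NE b (acc larger) c<b r<σb with T? (isRLmax σ b)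
  ... | yes isMax = b , isMax , c<b , r<σb
  ... | no ¬isMax with ¬RLmax⇒NE ¬isMax
  ... | b′ , b<b′ , σb<σb′ =
    RLmax-NE b′ (larger b<b′) (ℕ.<-trans c<b b<b′) (ℕ.<-trans r<σb σb<σb′)

  LR-below : Fin n → Fin n → Fin n → Bool
  LR-below c r a = isLRmin σ a ∧ (a <ᵇ c) ∧ (σ a <ᵇ r)

  RL-above : Fin n → Fin n → Fin n → Bool
  RL-above c r b = isRLmax σ b ∧ (c <ᵇ b) ∧ (r <ᵇ σ b)

  LR-below⇔SW : ∀ {c r} → T (any (LR-below c r) (allFin n)) ⇔ SW c r
  LR-below⇔SW {c} {r} = mk⇔ entry witness
    where
    entry : T (any (LR-below c r) (allFin n)) → SW c r
    entry t with to (any-allFin _) t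
    ... | a , t′ with to T-∧ (proj₂ (to (T-∧ {isLRmin σ a}) t′))
    ... | a<c , σa<r = a , to <ᵇ⇔< a<c , to <ᵇ⇔< σa<r
    witness : SW c r → T (any (LR-below c r) (allFin n))
    witness (a , a<c , σa<r) with LRmin-SW a (<-wellFounded a) a<c σa<r
    ... | a′ , isMin , a′<c , σa′<r =
      from (any-allFin _) (a′ , from T-∧ (isMin , from T-∧ (from <ᵇ⇔< a′<c , from <ᵇ⇔< σa′<r)))

  RL-above⇔NE : ∀ {c r} → T (any (RL-above c r) (allFin n)) ⇔ NE c r
  RL-above⇔NE {c} {r} = mk⇔ entry witness
    where
    entry : T (any (RL-above c r) (allFin n)) → NE c r
    entry t with to (any-allFin _) t
    ... | b , t′ with to T-∧ (proj₂ (to (T-∧ {isRLmax σ b}) t′))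
    ... | c<b , r<σb = b , to <ᵇ⇔< c<b , to <ᵇ⇔< r<σb
    witness : NE c r → T (any (RL-above c r) (allFin n))
    witness (b , c<b , r<σb) with RLmax-NE b (>-wellFounded b) c<b r<σb
    ... | b′ , isMax , c<b′ , r<σb′ =
      from (any-allFin _) (b′ , from T-∧ (isMax , from T-∧ (from <ᵇ⇔< c<b′ , from <ᵇ⇔< r<σb′)))

  Inside : Fin n → Fin n → Set
  Inside c r = SW c r × NE c r

  region⇔ : ∀ {c r} → T (inRegion σ c r) ⇔ Inside c r
  region⇔ = mk⇔ (λ t → let (sw , ne) = to T-∧ t in to LR-below⇔SW sw , to RL-above⇔NE ne)
                (λ (sw , ne) → from T-∧ (from LR-below⇔SW sw , from RL-above⇔NE ne))

  Interior : Fin n → Set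
  Interior c = Inside c (σ c)

  interior⇒¬special : ∀ {c} → Interior c → ¬ T (special σ c)
  interior⇒¬special (sw , ne) t with to T-∨ t
  ... | inj₁ isMin = LRmin⇒¬SW isMin sw
  ... | inj₂ isMax = RLmax⇒¬NE isMax ne

  interior⇒keptCol : ∀ {c} → Interior c → T (keptCol σ c)
  interior⇒keptCol = T-not ∘ interior⇒¬special

  interior⇒keptRow : ∀ {c} → Interior c → T (keptRow σ (σ c))
  interior⇒keptRow {c} inside = T-not special-in-row
    where
    -- the only entry in row σ c is c itself
    special-in-row : ¬ T (any (λ i → (σ i ≡ᵇ σ c) ∧ special σ i) (allFin n))
    special-in-row t with to (any-allFin _) t
    ... | i , t′ with to (T-∧ {σ i ≡ᵇ σ c}) t′
    ... | σi≡σc , isSpecial =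
      interior⇒¬special inside (subst (T ∘ special σ) (σ-injective (to ≡ᵇ⇔≡ σi≡σc)) isSpecial)

  cellAt : Fin n → Fin n → Maybe Bool
  cellAt c r = if inRegion σ c r then just (σ c ≡ᵇ r) else nothing

  cell-filled : ∀ {c r} → Inside c r → cellAt c r ≡ just (σ c ≡ᵇ r)
  cell-filled inside rewrite to T-≡ (from region⇔ inside) = refl

  cell-one : ∀ {c} → Interior c → cellAt c (σ c) ≡ just true
  cell-one {c} inside = trans (cell-filled inside) (cong just (to T-≡ (from (≡ᵇ⇔≡ {i = σ c}) refl)))

  cell-zero : ∀ {c r} → Inside c r → σ c ≢ r → cellAt c r ≡ just false
  cell-zero inside σc≢r = trans (cell-filled inside) (cong just (to T-not-≡ (T-not (σc≢r ∘ to ≡ᵇ⇔≡))))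

  cell-empty : ∀ {c r} → ¬ Inside c r → cellAt c r ≡ nothing
  cell-empty {c} {r} outside with inRegion σ c r in eq
  ... | true = ⊥-elim (outside (to region⇔ (subst T (sym eq) tt)))
  ... | false = refl

  cell-filled⁻ : ∀ {c r b} → cellAt c r ≡ just b → Inside c r
  cell-filled⁻ {c} {r} e with inRegion σ c r in eq
  cell-filled⁻ e  | true = to region⇔ (subst T (sym eq) tt)
  cell-filled⁻ () | false

  cell-one⁻ : ∀ {c r} → cellAt c r ≡ just true → r ≡ σ c
  cell-one⁻ {c} {r} e with inRegion σ c r
  cell-one⁻ e  | true = sym (to ≡ᵇ⇔≡ (subst T (sym (just-injective e)) tt))
  cell-one⁻ () | false

  cell-empty⁻ : ∀ {c r} → cellAt c r ≡ nothing → ¬ Inside c r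
  cell-empty⁻ {c} {r} e inside with inRegion σ c r in eq
  cell-empty⁻ () inside | true
  cell-empty⁻ e  inside | false = subst T eq (from region⇔ inside)

  ¬SW⇒right : ∀ {c r x} → ¬ SW c r → σ x < r → x ≢ c → c < x
  ¬SW⇒right outside σx<r x≢c = ≮∧≢⇒> (λ x<c → outside (_ , x<c , σx<r)) x≢c

  ¬SW⇒above : ∀ {c r x} → ¬ SW c r → x < c → σ x ≢ r → r < σ x
  ¬SW⇒above outside x<c σx≢r = ≮∧≢⇒> (λ σx<r → outside (_ , x<c , σx<r)) σx≢r

  ¬NE⇒left : ∀ {c r x} → ¬ NE c r → r < σ x → x ≢ c → x < c
  ¬NE⇒left outside r<σx x≢c = ≮∧≢⇒> (λ c<x → outside (_ , c<x , r<σx)) (x≢c ∘ sym)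

  ¬NE⇒below : ∀ {c r x} → ¬ NE c r → c < x → σ x ≢ r → σ x < r
  ¬NE⇒below outside c<x σx≢r = ≮∧≢⇒> (λ r<σx → outside (_ , c<x , r<σx)) (σx≢r ∘ sym)

  -- A copy of the board B′ inside B σ, described by the original columns
  -- and rows of σ that it occupies.
  record Placement (B′ : Board) : Set where
    constructor placement
    field
      col : Fin (cols B′) → Fin n
      row : Fin (rows B′) → Fin n
      col-increasing : StrictlyIncreasing col
      row-increasing : StrictlyIncreasing row
      col-kept : ∀ i → T (keptCol σ (col i))
      row-kept : ∀ j → T (keptRow σ (row j))
      cells : ∀ i j → cellAt (col i) (row j) ≡ cell B′ i j

    col< : ∀ i j → {True (i <? j)} → col i < col j
    col< i j {t} = col-increasing i j (lit i j {t})

    row< : ∀ i j → {True (i <? j)} → row i < row j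
    row< i j {t} = row-increasing i j (lit i j {t})

  placement⇔ : ∀ {B′} → BContains (B σ) B′ ⇔ Placement B′
  placement⇔ {B′} = mk⇔ place unplace
    where
    module Cols = Enumeration (keptCol σ)
    module Rows = Enumeration (keptRow σ)
    place : BContains (B σ) B′ → Placement B′
    place (f , g , f-increasing , g-increasing , cells) = record
      { col = Cols.elem ∘ f
      ; row = Rows.elem ∘ g
      ; col-increasing = λ i j i<j → Cols.elem-increasing _ _ (f-increasing i j i<j)
      ; row-increasing = λ i j i<j → Rows.elem-increasing _ _ (g-increasing i j i<j)
      ; col-kept = Cols.elem-passes ∘ f
      ; row-kept = Rows.elem-passes ∘ g
      ; cells = cells
      }
    unplace : Placement B′ → BContains (B σ) B′
    unplace P with Cols.subfamily col col-increasing col-kept | Rows.subfamily row row-increasing row-kept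
      where open Placement P
    ... | f , f-increasing , elem∘f | g , g-increasing , elem∘g =
      f , g , f-increasing , g-increasing ,
      λ i j → trans (cong₂ cellAt (elem∘f i) (elem∘g j)) (Placement.cells P i j)

  empty-below-filled : ∀ {c r r′ b} → cellAt c r ≡ nothing → cellAt c r′ ≡ just b → r < r′ → ¬ SW c r
  empty-below-filled empty filled r<r′ sw with cell-filled⁻ filled
  ... | _ , (d , c<d , r′<σd) = cell-empty⁻ empty (sw , (d , c<d , ℕ.<-trans r<r′ r′<σd))

  empty-above-filled : ∀ {c r r′ b} → cellAt c r ≡ nothing → cellAt c r′ ≡ just b → r′ < r → ¬ NE c r
  empty-above-filled empty filled r′<r ne with cell-filled⁻ filled
  ... | (a , a<c , σa<r′) , _ = cell-empty⁻ empty ((a , a<c , ℕ.<-trans σa<r′ r′<r) , ne)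

  Framed : Fin n → Fin n → Fin n → Set
  Framed a d x = a < x × σ a < σ x × x < d × σ x < σ d

  framed-inside : ∀ {a d x y} → Framed a d x → Framed a d y → Inside x (σ y)
  framed-inside {a} {d} (a<x , _ , x<d , _) (_ , σa<σy , _ , σy<σd) = (a , a<x , σa<σy) , (d , x<d , σy<σd)

  framed-pair-B1234 : ∀ {a d x y} → Framed a d x → Framed a d y → x < y → σ x < σ y → Placement B1234
  framed-pair-B1234 {x = x} {y} fx fy x<y σx<σy = placement
    (λ i → vlookup (x ∷ y ∷ []) i) (λ j → vlookup (σ x ∷ σ y ∷ []) j)
    (chain⇒increasing _ λ { fz → x<y }) (chain⇒increasing _ λ { fz → σx<σy })
    (λ { fz → interior⇒keptCol (framed-inside fx fx) ; (fs fz) → interior⇒keptCol (framed-inside fy fy) })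
    (λ { fz → interior⇒keptRow (framed-inside fx fx) ; (fs fz) → interior⇒keptRow (framed-inside fy fy) })
    λ { fz fz → cell-one (framed-inside fx fx)
      ; fz (fs fz) → cell-zero (framed-inside fx fy) (<⇒≢ σx<σy)
      ; (fs fz) fz → cell-zero (framed-inside fy fx) (<⇒≢ σx<σy ∘ sym)
      ; (fs fz) (fs fz) → cell-one (framed-inside fy fy) }

  framed-pair-B1324 : ∀ {a d x y} → Framed a d x → Framed a d y → x < y → σ y < σ x → Placement B1324
  framed-pair-B1324 {x = x} {y} fx fy x<y σy<σx = placement
    (λ i → vlookup (x ∷ y ∷ []) i) (λ j → vlookup (σ y ∷ σ x ∷ []) j)
    (chain⇒increasing _ λ { fz → x<y }) (chain⇒increasing _ λ { fz → σy<σx })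
    (λ { fz → interior⇒keptCol (framed-inside fx fx) ; (fs fz) → interior⇒keptCol (framed-inside fy fy) })
    (λ { fz → interior⇒keptRow (framed-inside fy fy) ; (fs fz) → interior⇒keptRow (framed-inside fx fx) })
    λ { fz fz → cell-zero (framed-inside fx fy) (<⇒≢ σy<σx ∘ sym)
      ; fz (fs fz) → cell-one (framed-inside fx fx)
      ; (fs fz) fz → cell-one (framed-inside fy fy)
      ; (fs fz) (fs fz) → cell-zero (framed-inside fy fx) (<⇒≢ σy<σx) }

  -- Part (1): an occurrence of 1234 gives B1234 on its two middle entries,
  -- which are framed by the outer two; conversely the two 1's of a copy of
  -- B1234, with an entry south-west of the first and north-east of the second,
  -- form a 1234.
  1234⇒B1234 : Contains σ p1234 → Placement B1234
  1234⇒B1234 occ = framed-pair-B1234 framed₁ framed₂ (pos< (# 1) (# 2)) (val< (# 1) (# 2))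
    where
    open Occurrence σ occ
    framed₁ : Framed (pos (# 0)) (pos (# 3)) (pos (# 1))
    framed₁ = pos< (# 0) (# 1) , val< (# 0) (# 1) , pos< (# 1) (# 3) , val< (# 1) (# 3)
    framed₂ : Framed (pos (# 0)) (pos (# 3)) (pos (# 2))
    framed₂ = pos< (# 0) (# 2) , val< (# 0) (# 2) , pos< (# 2) (# 3) , val< (# 2) (# 3)

  B1234⇒1234 : Placement B1234 → Contains σ p1234
  B1234⇒1234 P = from-corners (cell-filled⁻ (cells (# 0) (# 0))) (cell-filled⁻ (cells (# 1) (# 1)))
    where
    open Placement P
    r₀≡σc₀ : row (# 0) ≡ σ (col (# 0))
    r₀≡σc₀ = cell-one⁻ (cells (# 0) (# 0))
    r₁≡σc₁ : row (# 1) ≡ σ (col (# 1))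
    r₁≡σc₁ = cell-one⁻ (cells (# 1) (# 1))
    from-corners : Inside (col (# 0)) (row (# 0)) → Inside (col (# 1)) (row (# 1)) → Contains σ p1234
    from-corners ((a , a<c₀ , σa<r₀) , _) (_ , (d , c₁<d , r₁<σd)) =
      1234-occurrence σ a<c₀ (col< (# 0) (# 1)) c₁<d
        (<-respʳ-≡ r₀≡σc₀ σa<r₀)
        (<-respʳ-≡ r₁≡σc₁ (<-respˡ-≡ r₀≡σc₀ (row< (# 0) (# 1))))
        (<-respˡ-≡ r₁≡σc₁ r₁<σd)

  -- Part (2), pattern 1324: the same correspondence, the middle entries now
  -- being in decreasing order.
  1324⇒B1324 : Contains σ p1324 → Placement B1324
  1324⇒B1324 occ = framed-pair-B1324 framed₁ framed₂ (pos< (# 1) (# 2)) (val< (# 2) (# 1))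
    where
    open Occurrence σ occ
    framed₁ : Framed (pos (# 0)) (pos (# 3)) (pos (# 1))
    framed₁ = pos< (# 0) (# 1) , val< (# 0) (# 1) , pos< (# 1) (# 3) , val< (# 1) (# 3)
    framed₂ : Framed (pos (# 0)) (pos (# 3)) (pos (# 2))
    framed₂ = pos< (# 0) (# 2) , val< (# 0) (# 2) , pos< (# 2) (# 3) , val< (# 2) (# 3)

  B1324⇒1324 : Placement B1324 → Contains σ p1324
  B1324⇒1324 P = from-corners (cell-filled⁻ (cells (# 0) (# 0))) (cell-filled⁻ (cells (# 1) (# 1)))
    where
    open Placement P
    r₁≡σc₀ : row (# 1) ≡ σ (col (# 0))
    r₁≡σc₀ = cell-one⁻ (cells (# 0) (# 1))
    r₀≡σc₁ : row (# 0) ≡ σ (col (# 1))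
    r₀≡σc₁ = cell-one⁻ (cells (# 1) (# 0))
    from-corners : Inside (col (# 0)) (row (# 0)) → Inside (col (# 1)) (row (# 1)) → Contains σ p1324
    from-corners ((a , a<c₀ , σa<r₀) , _) (_ , (d , c₁<d , r₁<σd)) =
      1324-occurrence σ a<c₀ (col< (# 0) (# 1)) c₁<d
        (<-respʳ-≡ r₀≡σc₁ σa<r₀)
        (<-respʳ-≡ r₁≡σc₀ (<-respˡ-≡ r₀≡σc₁ (row< (# 0) (# 1))))
        (<-respˡ-≡ r₁≡σc₀ r₁<σd)

  -- Part (2), pattern 3416725.  In an occurrence of 3416725 the entries
  -- 4, 6, 2 give B3416725: its filled cells have the entries 3 or 1 to their
  -- south-west and 7 or 5 to their north-east, and its two empty corners are
  -- empty because an entry south-west of the lower-left one, or north-east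
  -- of the upper-right one, would complete a 1324.
  3416725⇒B3416725 : Avoids σ p1324 → Contains σ p3416725 → Placement B3416725
  3416725⇒B3416725 avoids occ = placement col row
    (chain⇒increasing col λ { fz → pos< (# 1) (# 3) ; (fs fz) → pos< (# 3) (# 5) })
    (chain⇒increasing row λ { fz → val< (# 5) (# 1) ; (fs fz) → val< (# 1) (# 3) })
    (λ { fz → interior⇒keptCol interior₁ ; (fs fz) → interior⇒keptCol interior₃
       ; (fs (fs fz)) → interior⇒keptCol interior₅ })
    (λ { fz → interior⇒keptRow interior₅ ; (fs fz) → interior⇒keptRow interior₁
       ; (fs (fs fz)) → interior⇒keptRow interior₃ })
    cells
    where
    open Occurrence σ occ
    p₁ p₃ p₅ : Fin n
    p₁ = pos (# 1) ; p₃ = pos (# 3) ; p₅ = pos (# 5)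
    col row : Fin 3 → Fin n
    col i = vlookup (p₁ ∷ p₃ ∷ p₅ ∷ []) i
    row j = vlookup (σ p₅ ∷ σ p₁ ∷ σ p₃ ∷ []) j
    -- witnesses south-west of a cell: the entries at positions 0 and 2;
    -- north-east of it: the entries at positions 4 and 6
    SW-of : ∀ k {c r} → pos k < c → σ (pos k) < r → SW c r
    SW-of k k<c σk<r = pos k , k<c , σk<r
    NE-of : ∀ k {c r} → c < pos k → r < σ (pos k) → NE c r
    NE-of k c<k r<σk = pos k , c<k , r<σk
    interior₁ : Interior p₁
    interior₁ = SW-of (# 0) (pos< (# 0) (# 1)) (val< (# 0) (# 1)) , NE-of (# 4) (pos< (# 1) (# 4)) (val< (# 1) (# 4))
    interior₃ : Interior p₃
    interior₃ = SW-of (# 2) (pos< (# 2) (# 3)) (val< (# 2) (# 3)) , NE-of (# 4) (pos< (# 3) (# 4)) (val< (# 3) (# 4))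
    interior₅ : Interior p₅
    interior₅ = SW-of (# 2) (pos< (# 2) (# 5)) (val< (# 2) (# 5)) , NE-of (# 6) (pos< (# 5) (# 6)) (val< (# 5) (# 6))
    no-SW-corner : ¬ SW p₁ (σ p₅)
    no-SW-corner (a , a<p₁ , σa<σp₅) = avoids (1324-occurrence σ a<p₁ (pos< (# 1) (# 5)) (pos< (# 5) (# 6))
                                                 σa<σp₅ (val< (# 5) (# 1)) (val< (# 1) (# 6)))
    no-NE-corner : ¬ NE p₅ (σ p₃)
    no-NE-corner (b , p₅<b , σp₃<σb) = avoids (1324-occurrence σ (pos< (# 2) (# 3)) (pos< (# 3) (# 5)) p₅<b
                                                 (val< (# 2) (# 5)) (val< (# 5) (# 3)) σp₃<σb)
    cells : ∀ i j → cellAt (col i) (row j) ≡ cell B3416725 i j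
    cells fz fz = cell-empty (no-SW-corner ∘ proj₁)
    cells fz (fs fz) = cell-one interior₁
    cells fz (fs (fs fz)) = cell-zero
      (SW-of (# 0) (pos< (# 0) (# 1)) (val< (# 0) (# 3)) , NE-of (# 4) (pos< (# 1) (# 4)) (val< (# 3) (# 4)))
      (<⇒≢ (val< (# 1) (# 3)))
    cells (fs fz) fz = cell-zero
      (SW-of (# 2) (pos< (# 2) (# 3)) (val< (# 2) (# 5)) , NE-of (# 4) (pos< (# 3) (# 4)) (val< (# 5) (# 4)))
      (<⇒≢ (val< (# 5) (# 3)) ∘ sym)
    cells (fs fz) (fs fz) = cell-zero
      (SW-of (# 0) (pos< (# 0) (# 3)) (val< (# 0) (# 1)) , NE-of (# 4) (pos< (# 3) (# 4)) (val< (# 1) (# 4)))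
      (<⇒≢ (val< (# 1) (# 3)) ∘ sym)
    cells (fs fz) (fs (fs fz)) = cell-one interior₃
    cells (fs (fs fz)) fz = cell-one interior₅
    cells (fs (fs fz)) (fs fz) = cell-zero
      (SW-of (# 0) (pos< (# 0) (# 5)) (val< (# 0) (# 1)) , NE-of (# 6) (pos< (# 5) (# 6)) (val< (# 1) (# 6)))
      (<⇒≢ (val< (# 5) (# 1)))
    cells (fs (fs fz)) (fs (fs fz)) = cell-empty (no-NE-corner ∘ proj₂)

  -- Conversely, let columns c₀ < c₁ < c₂ and rows r₀ < r₁ < r₂ carry a copy
  -- of B3416725, with 1's at (c₀ , r₁), (c₁ , r₂), (c₂ , r₀).  Filled cells
  -- provide entries a₀, a₁ to the south-west and b₁, b₂ to the north-east,
  -- and the two empty corners force  a₀ c₀ a₁ c₁ b₁ c₂ b₂  to form a 3416725.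
  B3416725⇒3416725 : Placement B3416725 → Contains σ p3416725
  B3416725⇒3416725 P = assemble
    (proj₁ (cell-filled⁻ (cells (# 0) (# 1)))) (proj₁ (cell-filled⁻ (cells (# 1) (# 0))))
    (proj₂ (cell-filled⁻ (cells (# 1) (# 2)))) (proj₂ (cell-filled⁻ (cells (# 2) (# 1))))
    where
    open Placement P
    c₀ c₁ c₂ r₀ r₁ r₂ : Fin n
    c₀ = col (# 0) ; c₁ = col (# 1) ; c₂ = col (# 2)
    r₀ = row (# 0) ; r₁ = row (# 1) ; r₂ = row (# 2)
    r₁≡σc₀ : r₁ ≡ σ c₀
    r₁≡σc₀ = cell-one⁻ (cells (# 0) (# 1))
    r₂≡σc₁ : r₂ ≡ σ c₁
    r₂≡σc₁ = cell-one⁻ (cells (# 1) (# 2))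
    r₀≡σc₂ : r₀ ≡ σ c₂
    r₀≡σc₂ = cell-one⁻ (cells (# 2) (# 0))
    no-SW : ¬ SW c₀ r₀
    no-SW = empty-below-filled (cells (# 0) (# 0)) (cells (# 0) (# 2)) (row< (# 0) (# 2))
    no-NE : ¬ NE c₂ r₂
    no-NE = empty-above-filled (cells (# 2) (# 2)) (cells (# 2) (# 0)) (row< (# 0) (# 2))
    assemble : SW c₀ r₁ → SW c₁ r₀ → NE c₁ r₂ → NE c₂ r₁ → Contains σ p3416725
    assemble (a₀ , a₀<c₀ , σa₀<r₁) (a₁ , a₁<c₁ , σa₁<r₀) (b₁ , c₁<b₁ , r₂<σb₁) (b₂ , c₂<b₂ , r₁<σb₂) =
      occurrence σ p3416725 p3416725⁻¹ p3416725⁻¹∘p3416725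
        (λ i → vlookup (a₀ ∷ c₀ ∷ a₁ ∷ c₁ ∷ b₁ ∷ c₂ ∷ b₂ ∷ []) i)
        (λ { fz → a₀<c₀ ; (fs fz) → c₀<a₁ ; (fs (fs fz)) → a₁<c₁ ; (fs (fs (fs fz))) → c₁<b₁
           ; (fs (fs (fs (fs fz)))) → b₁<c₂ ; (fs (fs (fs (fs (fs fz))))) → c₂<b₂ })
        (λ { fz → <-respʳ-≡ r₀≡σc₂ σa₁<r₀ ; (fs fz) → <-respˡ-≡ r₀≡σc₂ r₀<σa₀
           ; (fs (fs fz)) → <-respʳ-≡ r₁≡σc₀ σa₀<r₁ ; (fs (fs (fs fz))) → <-respˡ-≡ r₁≡σc₀ r₁<σb₂
           ; (fs (fs (fs (fs fz)))) → <-respʳ-≡ r₂≡σc₁ σb₂<r₂ ; (fs (fs (fs (fs (fs fz))))) → <-respˡ-≡ r₂≡σc₁ r₂<σb₁ })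
      where
      -- a₁ lies below r₁ = σ c₀, so it is not c₀, and it cannot be left of c₀
      c₀<a₁ : c₀ < a₁
      c₀<a₁ = ¬SW⇒right no-SW σa₁<r₀
        (λ a₁≡c₀ → <⇒≢ (ℕ.<-trans σa₁<r₀ (row< (# 0) (# 1))) (trans (cong σ a₁≡c₀) (sym r₁≡σc₀)))
      -- a₀ is left of c₂, so it is not in row r₀ = σ c₂, and it cannot be below r₀
      r₀<σa₀ : r₀ < σ a₀
      r₀<σa₀ = ¬SW⇒above no-SW a₀<c₀
        (λ σa₀≡r₀ → <⇒≢ (ℕ.<-trans a₀<c₀ (col< (# 0) (# 2))) (σ-injective (trans σa₀≡r₀ r₀≡σc₂)))
      -- b₁ lies above r₂ > σ c₂, so it is not c₂, and it cannot be right of c₂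
      b₁<c₂ : b₁ < c₂
      b₁<c₂ = ¬NE⇒left no-NE r₂<σb₁
        (λ b₁≡c₂ → <⇒≢ (ℕ.<-trans (row< (# 0) (# 2)) r₂<σb₁) (trans r₀≡σc₂ (cong σ (sym b₁≡c₂))))
      -- b₂ is right of c₁, so it is not in row r₂ = σ c₁, and it cannot be above r₂
      σb₂<r₂ : σ b₂ < r₂
      σb₂<r₂ = ¬NE⇒below no-NE c₂<b₂
        (λ σb₂≡r₂ → <⇒≢ (ℕ.<-trans (col< (# 1) (# 2)) c₂<b₂) (sym (σ-injective (trans σb₂≡r₂ r₂≡σc₁))))

  1234⇔B1234 : Contains σ p1234 ⇔ BContains (B σ) B1234
  1234⇔B1234 = mk⇔ (from placement⇔ ∘ 1234⇒B1234) (B1234⇒1234 ∘ to placement⇔)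

  1324⇔B1324 : Contains σ p1324 ⇔ BContains (B σ) B1324
  1324⇔B1324 = mk⇔ (from placement⇔ ∘ 1324⇒B1324) (B1324⇒1324 ∘ to placement⇔)

  3416725⇔B3416725 : Avoids σ p1324 → Contains σ p3416725 ⇔ BContains (B σ) B3416725
  3416725⇔B3416725 avoids = mk⇔ (from placement⇔ ∘ 3416725⇒B3416725 avoids) (B3416725⇒3416725 ∘ to placement⇔)

lemma1p3 : ∀ (n : ℕ) (σ : Permutation′ n) →
    (Avoids (σ ⟨$⟩ʳ_) p1234 ⇔ BAvoids (B (σ ⟨$⟩ʳ_)) B1234)
    × ((Avoids (σ ⟨$⟩ʳ_) p1324 × Avoids (σ ⟨$⟩ʳ_) p3416725)
        ⇔ (BAvoids (B (σ ⟨$⟩ʳ_)) B1324 × BAvoids (B (σ ⟨$⟩ʳ_)) B3416725))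
lemma1p3 n σ = ¬-cong-⇔ 1234⇔B1234 , mk⇔
  (λ (avoids1324 , avoids3416725) →
     to avoids1324⇔ avoids1324 , to (¬-cong-⇔ (3416725⇔B3416725 avoids1324)) avoids3416725)
  (λ (bavoids1324 , bavoids3416725) → let avoids1324 = from avoids1324⇔ bavoids1324 in
     avoids1324 , from (¬-cong-⇔ (3416725⇔B3416725 avoids1324)) bavoids3416725)
  where
  open Geometry (σ ⟨$⟩ʳ_) (Injection.injective (↔⇒↣ σ))
  avoids1324⇔ : Avoids (σ ⟨$⟩ʳ_) p1324 ⇔ BAvoids (B (σ ⟨$⟩ʳ_)) B1324
  avoids1324⇔ = ¬-cong-⇔ 1324⇔B1324
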